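{- Let $\models_{\mathsf{QCC/TT}}$ be the consequence relation of the logic $\mathsf{QCC/TT}$ described in the context. Then for all formulae $A,B$: (1) $A\supset B\models_{\mathsf{QCC/TT}}A\to B$, but in general $A\to B\not\models_{\mathsf{QCC/TT}}A\supset B$; (2) in general $\not\models_{\mathsf{QCC/TT}}(A\supset B)\supset\!\subset(A\to B)$; (3) in general $\not\models_{\mathsf{QCC/TT}}(A\supset B)\leftrightarrow(A\to B)$.
   Context: Formulae are built from propositional variables with $\neg,\wedge,\vee,\to$. A $\mathsf{QCC}$-evaluation is a map $v$ from formulae to $\{0,\tfrac12,1\}$ with $v(\neg A)=1-v(A)$; quasi-conjunction: $v(A\wedge B)=0$ if either conjunct has value $0$, $=\tfrac12$ if both have value $\tfrac12$, and $=1$ otherwise (so $1\wedge\tfrac12=\tfrac12\wedge 1=1$); quasi-disjunction: $v(A\vee B)=1$ if either disjunct has value $1$, $=\tfrac12$ if both have value $\tfrac12$, and $=0$ otherwise (so $0\vee\tfrac12=\tfrac12\vee0=0$); and the Cooper–Cantwell conditional: $v(A\to B)=v(B)$ if $v(A)\in\{1,\tfrac12\}$, and $=\tfrac12$ if $v(A)=0$. The (quasi-)material conditional $A\supset B$ is $\neg A\vee B$ (equivalently $\neg(A\wedge\neg B)$); thus $v(A\supset B)=1$ if $v(A)=0$; $=v(B)$ if $v(A)=\tfrac12$; and if $v(A)=1$ it is $1$ when $v(B)=1$ and $0$ otherwise. Consequence is tolerant-to-tolerant: $A\models_{\mathsf{QCC/TT}}C$ iff for every $\mathsf{QCC}$-evaluation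 $v$, $v(A)\in\{\tfrac12,1\}$ implies $v(C)\in\{\tfrac12,1\}$; $\models_{\mathsf{QCC/TT}}C$ iff $v(C)\in\{\tfrac12,1\}$ for all $v$. The material biconditional $A\supset\!\subset B$ is $(A\supset B)\wedge(B\supset A)$ and the indicative biconditional $A\leftrightarrow B$ is $(A\to B)\wedge(B\to A)$. -}

module Defs where

open import Data.Nat using (ℕ)

-- Truth values {0, 1/2, 1}
data V3 : Set where
  v0 vh v1 : V3

data Formula : Set where
  var  : ℕ → Formula
  ¬'_  : Formula → Formula
  _∧'_ : Formula → Formula → Formula
  _∨'_ : Formula → Formula → Formula
  _⇒_  : Formula → Formula → Formula   -- Cooper–Cantwell conditional A → B

infixr 4 _⇒_
infixr 5 _∨'_
infixr 6 _∧'_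
infix 7 ¬'_

neg3 : V3 → V3
neg3 v0 = v1
neg3 vh = vh
neg3 v1 = v0

conj3 : V3 → V3 → V3
conj3 v0 _  = v0
conj3 _  v0 = v0
conj3 vh vh = vh
conj3 _  _  = v1

disj3 : V3 → V3 → V3
disj3 v1 _  = v1
disj3 _  v1 = v1
disj3 vh vh = vh
disj3 _  _  = v0

cc3 : V3 → V3 → V3
cc3 v0 _ = vh
cc3 vh b = b
cc3 v1 b = b

eval : (ℕ → V3) → Formula → V3
eval ρ (var n)   = ρ n
eval ρ (¬' A)    = neg3 (eval ρ A)
eval ρ (A ∧' B)  = conj3 (eval ρ A) (eval ρ B)
eval ρ (A ∨' B)  = disj3 (eval ρ A) (eval ρ B)
eval ρ (A ⇒ B)   = cc3 (eval ρ A) (eval ρ B)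

_⊃_ : Formula → Formula → Formula
A ⊃ B = ¬' A ∨' B

_⊃⊂_ : Formula → Formula → Formula
A ⊃⊂ B = (A ⊃ B) ∧' (B ⊃ A)

_⇔'_ : Formula → Formula → Formula
A ⇔' B = (A ⇒ B) ∧' (B ⇒ A)

-- designated (tolerant) values: 1/2 and 1
data Designated : V3 → Set where
  des-h : Designated vh
  des-1 : Designated v1

_⊨_ : Formula → Formula → Set
A ⊨ C = (ρ : ℕ → V3) → Designated (eval ρ A) → Designated (eval ρ C)

⊨_ : Formula → Set
⊨ C = (ρ : ℕ → V3) → Designated (eval ρ C)

module Submission where

-- (1, positive half) A ⊃ B ⊨ A → B holds value-wise: whenever ¬a ∨ b is
-- designated, so is the Cooper–Cantwell value of a → b.
--
-- The three negative claims share one countermodel: p := var 0 gets value 1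
-- and q := var 1 gets value 1/2.  Then p → q = 1/2 is designated while
-- p ⊃ q = 0 ∨ 1/2 = 0, and both biconditionals between them evaluate to 0
-- (a quasi-conjunction with a conjunct of value 0).  Since 0 is the only
-- undesignated value, a formula of value 0 is neither valid nor a consequence
-- of a designated premise (`not-valid-at`, `not-consequence-at`).

open import Defs
open import Data.Nat using (ℕ; zero; suc)
open import Data.Product using (_×_; ∃₂; _,_)
open import Relation.Binary.PropositionalEquality using (_≡_; refl; subst)
open import Relation.Nullary using (¬_)

material⇒indicative-value : (a b : V3) →
  Designated (disj3 (neg3 a) b) → Designated (cc3 a b)
material⇒indicative-value v0 b  _ = des-h
material⇒indicative-value vh vh _ = des-h
material⇒indicative-value vh v1 _ = des-1
material⇒indicative-value v1 v1 _ = des-1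

material⊨indicative : (A B : Formula) → (A ⊃ B) ⊨ (A ⇒ B)
material⊨indicative A B ρ = material⇒indicative-value (eval ρ A) (eval ρ B)

v0-undesignated : ¬ Designated v0
v0-undesignated ()

not-valid-at : (C : Formula) (ρ : ℕ → V3) → eval ρ C ≡ v0 → ¬ (⊨ C)
not-valid-at C ρ C≡0 valid = v0-undesignated (subst Designated C≡0 (valid ρ))

not-consequence-at : (A C : Formula) (ρ : ℕ → V3) →
  Designated (eval ρ A) → eval ρ C ≡ v0 → ¬ (A ⊨ C)
not-consequence-at A C ρ A-des C≡0 entails =
  v0-undesignated (subst Designated C≡0 (entails ρ A-des))

p q : Formula
p = var 0
q = var 1

ρ₁½ : ℕ → V3
ρ₁½ zero    = v1
ρ₁½ (suc _) = vh

indicative-designated : Designated (eval ρ₁½ (p ⇒ q))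
indicative-designated = des-h

material-false : eval ρ₁½ (p ⊃ q) ≡ v0
material-false = refl

material-biconditional-false : eval ρ₁½ ((p ⊃ q) ⊃⊂ (p ⇒ q)) ≡ v0
material-biconditional-false = refl

indicative-biconditional-false : eval ρ₁½ ((p ⊃ q) ⇔' (p ⇒ q)) ≡ v0
indicative-biconditional-false = refl

mainTheorem3 : ((A B : Formula) → (A ⊃ B) ⊨ (A ⇒ B))
               × (∃₂ λ A B → ¬ ((A ⇒ B) ⊨ (A ⊃ B)))
               × (∃₂ λ A B → ¬ (⊨ ((A ⊃ B) ⊃⊂ (A ⇒ B))))
               × (∃₂ λ A B → ¬ (⊨ ((A ⊃ B) ⇔' (A ⇒ B))))
mainTheorem3 =
    material⊨indicative
  , (p , q , not-consequence-at (p ⇒ q) (p ⊃ q) ρ₁½ indicative-designated material-false)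
  , (p , q , not-valid-at ((p ⊃ q) ⊃⊂ (p ⇒ q)) ρ₁½ material-biconditional-false)
  , (p , q , not-valid-at ((p ⊃ q) ⇔' (p ⇒ q)) ρ₁½ indicative-biconditional-false)
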